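{- Let $\varepsilon\in(0,2)$. Every plane graph $G$ with minimum degree at least $3$ and average degree at least $4+\varepsilon$ has a vertex $v$ that sees at most $1+\lceil 8/\varepsilon\rceil$ other vertices.
   Context: A plane graph is a (finite, simple) planar graph together with an embedding in the plane. The average degree is $2|E(G)|/|V(G)|$. In an embedded graph, two distinct vertices $v$ and $w$ are visible (and $v$ sees $w$) if $v$ and $w$ appear on a common face, i.e. both lie on the boundary walk of some face.
   Formalization: The parameter ε ranges over the rationals in the open interval (0,2). -}

module Defs where

open import Data.Nat using (ℕ; zero; suc; _+_; _*_; _≤_; _<ᵇ_)
open import Data.Bool using (Bool; true; false; not; _∧_; _∨_; T)
open import Data.Fin using (Fin; toℕ)
open import Data.Fin.Properties using (_≟_)
open import Data.List using (List; []; _∷_; map; upTo; length; filterᵇ)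
open import Data.List.Base using (allFin)
open import Data.Product using (Σ; _×_; ∃)
open import Data.Empty using (⊥)
open import Data.Unit using (⊤)
open import Data.Sum using (_⊎_)
open import Relation.Nullary using (¬_; does)
open import Relation.Binary.PropositionalEquality using (_≡_; _≢_)
open import Data.Rational using (ℚ; 0ℚ; _<_; _÷_; positive)
open import Data.Rational.Properties using (pos⇒nonZero)
import Data.Rational as ℚ
open import Data.Integer using (+_)

iter : ∀ {A : Set} → (A → A) → ℕ → A → A
iter f zero    x = x
iter f (suc k) x = f (iter f k x)

any : ∀ {A : Set} → (A → Bool) → List A → Bool
any p []       = false
any p (x ∷ xs) = p x ∨ any p xs

all : ∀ {A : Set} → (A → Bool) → List A → Bool
all p []       = true
all p (x ∷ xs) = p x ∧ all p xs

fromℕ : ℕ → ℚ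
fromℕ k = (+ k) ℚ./ 1

_==_ : ∀ {m} → Fin m → Fin m → Bool
x == y = does (x ≟ y)

data Reach {n D : ℕ} (vert : Fin D → Fin n) (α : Fin D → Fin D)
           (ok : Fin D → Set) : Fin n → Fin n → Set where
  here : ∀ {u} → Reach vert α ok u u
  step : ∀ {w} (d : Fin D) → ok d → Reach vert α ok (vert (α d)) w →
         Reach vert α ok (vert d) w

φ : ∀ {D} → (Fin D → Fin D) → (Fin D → Fin D) → Fin D → Fin D
φ α σ d = σ (α d)

-- the orbit of d under a permutation f of Fin D (period ≤ D)
orbit : ∀ {D} → (Fin D → Fin D) → Fin D → List (Fin D)
orbit {D} f d = map (λ k → iter f k d) (upTo D)

-- number of face orbits (count orbit representatives = least element)
faceCount : ∀ {D} → (Fin D → Fin D) → (Fin D → Fin D) → ℕ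
faceCount {D} α σ =
  length (filterᵇ (λ d → all (λ e → not (toℕ e <ᵇ toℕ d)) (orbit (φ α σ) d))
                  (allFin D))

edgeCountM : ∀ {D} → (Fin D → Fin D) → ℕ
edgeCountM {D} α = length (filterᵇ (λ d → toℕ d <ᵇ toℕ (α d)) (allFin D))

eightOver : (ε : ℚ) → 0ℚ < ε → ℚ
eightOver ε ε>0 = (fromℕ 8 ÷ ε) {{pos⇒nonZero ε {{positive ε>0}}}}

-- G is encoded by a connected plane map M (rotation system on darts,
-- genus 0 via Euler's formula) on the same vertex set, together with a
-- set of "auxiliary" edges of M, each of which is a bridge of M.
-- G = M minus the auxiliary edges.  (Every plane graph arises this way:
-- join its components by edges drawn inside faces; such edges are
-- bridges and do not change the faces or their boundary vertex sets.)
-- The faces of G correspond to the face orbits of M (orbits of σ ∘ α),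
-- and the vertices on the boundary of a face are the vertices of the
-- darts in the corresponding orbit.
record PlaneGraph (n : ℕ) : Set where
  field
    D      : ℕ                      -- number of darts (half-edges) of M
    vert   : Fin D → Fin n          -- tail vertex of a dart
    α      : Fin D → Fin D          -- edge involution (reverse dart)
    σ      : Fin D → Fin D          -- rotation: next dart around tail vertex
    σ⁻     : Fin D → Fin D
    aux    : Fin D → Bool

    α-invol : ∀ d → α (α d) ≡ d
    α-nofix : ∀ d → α d ≢ d
    σ-left  : ∀ d → σ⁻ (σ d) ≡ d
    σ-right : ∀ d → σ (σ⁻ d) ≡ d
    σ-vert  : ∀ d → vert (σ d) ≡ vert d
    σ-cyc   : ∀ d d' → vert d ≡ vert d' → ∃ λ k → iter σ k d ≡ d'
    loopless : ∀ d → vert (α d) ≢ vert d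
    noMulti  : ∀ d d' → vert d ≡ vert d' → vert (α d) ≡ vert (α d') → d ≡ d'
    connected : ∀ u v → Reach vert α (λ _ → ⊤) u v
    -- M has genus 0 (Euler's formula V - E + F = 2 for a connected map);
    -- the dartless case is the one-vertex (or empty) map
    euler : D ≡ 0 ⊎ n + faceCount α σ ≡ edgeCountM α + 2
    aux-α    : ∀ d → aux (α d) ≡ aux d
    aux-bridge : ∀ d → T (aux d) →
                 ¬ Reach vert α (λ e → e ≢ d × e ≢ α d) (vert d) (vert (α d))

  deg : Fin n → ℕ
  deg v = length (filterᵇ (λ d → (vert d == v) ∧ not (aux d)) (allFin D))

  edgeCount : ℕ
  edgeCount = length (filterᵇ (λ d → (toℕ d <ᵇ toℕ (α d)) ∧ not (aux d)) (allFin D))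

  sees : Fin n → Fin n → Bool
  sees v w = not (v == w) ∧
    any (λ d → any (λ e → vert e == v) (orbit (φ α σ) d)
             ∧ any (λ e → vert e == w) (orbit (φ α σ) d)) (allFin D)

  visibleCount : Fin n → ℕ
  visibleCount v = length (filterᵇ (sees v) (allFin n))

module Submission where

-- Proof by discharging on the plane map M that encodes G.  Let k = ⌈8/ε⌉,
-- S = k + 2, and suppose every vertex sees at least S vertices.  Every face
-- of M has length ≥ 3 (M has no loops, and a face of length 2 would create
-- a vertex of degree 1).  A dart on a face of length l gives
-- vertexShare = min(l, S) - 3 to its vertex and faceShare = S - vertexShare
-- to its face.
--   * Vertex inequality: every vertex collects at least S from its darts
--     (counting 1 per dart): either one of its faces is longer than S, or
--     from each corner on a face of length l ≤ S it sees at most l - 2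
--     vertices.  Summing, nS ≤ D + Σ vertexShare (D darts).
--   * Face inequality: a face of length l ≥ 3 keeps l·faceShare ≥ 3S.
--     Summing, 3S·F ≤ Σ faceShare.
-- Adding gives nS + 3SF ≤ D(1 + S) = 2E(1 + S), and Euler's formula
-- n + F = E + 2 turns this into kE + 6S ≤ 2Sn.  This contradicts
-- 4kn + 8n ≤ 2kE, the density hypothesis (4 + ε)n ≤ 2|E(G)| ≤ 2E with the
-- denominator of ε cleared.

module FiniteSums where

  open import Defs using (_==_)
  open import Data.Bool using (Bool; true; false; T; _∧_)
  open import Data.Nat using (ℕ; zero; suc; _+_; _*_; _≤_; z≤n; s≤s)
  import Data.Nat.Properties as ℕP
  open import Data.Fin using (Fin; zero; suc)
  import Data.Fin.Properties as FinP
  open import Data.List using (length; filterᵇ; allFin; tabulate)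
  open import Data.Bool.Properties using (T?)
  open import Data.Product using (_,_)
  open import Data.Empty using (⊥-elim)
  open import Function using (_∘_)
  open import Relation.Nullary using (¬_; yes; no)
  open import Relation.Binary.PropositionalEquality
  open import Algebra.Properties.Semiring.Sum ℕP.+-*-semiring
    using (sum-syntax; sum-cong-≗; ∑-distrib-+)

  χ : Bool → ℕ
  χ true  = 1
  χ false = 0

  χ≤1 : ∀ b → χ b ≤ 1
  χ≤1 true  = s≤s z≤n
  χ≤1 false = z≤n

  χ-true : ∀ {b} → T b → χ b ≡ 1
  χ-true {true} _ = refl

  χ-false : ∀ {b} → ¬ T b → χ b ≡ 0
  χ-false {true}  ¬b = ⊥-elim (¬b _)
  χ-false {false} _  = refl

  χ-∧ : ∀ a b → χ (a ∧ b) ≡ χ a * χ b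
  χ-∧ true  b = sym (ℕP.+-identityʳ (χ b))
  χ-∧ false b = refl

  χ-∧≤ : ∀ a b → χ (a ∧ b) ≤ χ a
  χ-∧≤ true  b = χ≤1 b
  χ-∧≤ false b = z≤n

  χ≤ : ∀ {b X} → (T b → 1 ≤ X) → χ b ≤ X
  χ≤ {true}  1≤X = 1≤X _
  χ≤ {false} _   = z≤n

  χ*-cong : ∀ b {x y} → (T b → x ≡ y) → χ b * x ≡ χ b * y
  χ*-cong true  x≡y = cong (1 *_) (x≡y _)
  χ*-cong false _   = refl

  count-filter : ∀ {A : Set} m (f : Fin m → A) (p : A → Bool) →
    length (filterᵇ p (tabulate f)) ≡ ∑[ i < m ] χ (p (f i))
  count-filter zero    f p = refl
  count-filter (suc m) f p with p (f zero)
  ... | true  = cong suc (count-filter m (f ∘ suc) p)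
  ... | false = count-filter m (f ∘ suc) p

  count : ∀ m (p : Fin m → Bool) → length (filterᵇ p (allFin m)) ≡ ∑[ i < m ] χ (p i)
  count m = count-filter m (λ i → i)

  ∑-const : ∀ m c → ∑[ i < m ] c ≡ m * c
  ∑-const zero    c = refl
  ∑-const (suc m) c = cong (c +_) (∑-const m c)

  ∑-mono : ∀ m {g h : Fin m → ℕ} → (∀ i → g i ≤ h i) → ∑[ i < m ] g i ≤ ∑[ i < m ] h i
  ∑-mono zero    g≤h = z≤n
  ∑-mono (suc m) g≤h = ℕP.+-mono-≤ (g≤h zero) (∑-mono m (g≤h ∘ suc))

  ∑-zero : ∀ m {g : Fin m → ℕ} → (∀ i → g i ≡ 0) → ∑[ i < m ] g i ≡ 0
  ∑-zero m g≡0 = trans (sum-cong-≗ g≡0) (trans (∑-const m 0) (ℕP.*-zeroʳ m))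

  ∑-single : ∀ m (y : Fin m) (g : Fin m → ℕ) → (∀ i → i ≢ y → g i ≡ 0) → ∑[ i < m ] g i ≡ g y
  ∑-single (suc m) zero g vanish =
    trans (cong (g zero +_) (∑-zero m (λ i → vanish (suc i) λ ()))) (ℕP.+-identityʳ (g zero))
  ∑-single (suc m) (suc y) g vanish =
    cong₂ _+_ (vanish zero λ ()) (∑-single m y (g ∘ suc) (λ i i≢y → vanish (suc i) (i≢y ∘ FinP.suc-injective)))

  without : ∀ {m} → Fin m → (Fin m → ℕ) → Fin m → ℕ
  without y g i with i FinP.≟ y
  ... | yes _ = 0
  ... | no  _ = g i

  without-≢ : ∀ {m} (y i : Fin m) g → i ≢ y → without y g i ≡ g i
  without-≢ y i g i≢y with i FinP.≟ y
  ... | yes i≡y = ⊥-elim (i≢y i≡y)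
  ... | no  _   = refl

  ∑-split : ∀ m (y : Fin m) (g : Fin m → ℕ) → ∑[ i < m ] g i ≡ g y + ∑[ i < m ] without y g i
  ∑-split m y g = begin
    ∑[ i < m ] g i                                  ≡⟨ sum-cong-≗ parts ⟩
    ∑[ i < m ] (only i + without y g i)             ≡⟨ ∑-distrib-+ only (without y g) ⟩
    ∑[ i < m ] only i + ∑[ i < m ] without y g i    ≡⟨ cong (_+ rest) (∑-single m y only only-off) ⟩
    only y + ∑[ i < m ] without y g i               ≡⟨ cong (_+ rest) only-at ⟩
    g y + ∑[ i < m ] without y g i                  ∎
    where
    open ≡-Reasoning
    rest : ℕ
    rest = ∑[ i < m ] without y g i
    only : Fin m → ℕ
    only i with i FinP.≟ y
    ... | yes _ = g i
    ... | no  _ = 0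
    parts : ∀ i → g i ≡ only i + without y g i
    parts i with i FinP.≟ y
    ... | yes _ = sym (ℕP.+-identityʳ (g i))
    ... | no  _ = refl
    only-off : ∀ i → i ≢ y → only i ≡ 0
    only-off i i≢y with i FinP.≟ y
    ... | yes i≡y = ⊥-elim (i≢y i≡y)
    ... | no  _   = refl
    only-at : only y ≡ g y
    only-at with y FinP.≟ y
    ... | yes _   = refl
    ... | no  y≢y = ⊥-elim (y≢y refl)

  term≤∑ : ∀ m (y : Fin m) (g : Fin m → ℕ) → g y ≤ ∑[ i < m ] g i
  term≤∑ m y g = subst (g y ≤_) (sym (∑-split m y g)) (ℕP.m≤m+n _ _)

  ∑-injection : ∀ l m (f : Fin l → Fin m) → (∀ i j → f i ≡ f j → i ≡ j) →
    (g : Fin m → ℕ) → ∑[ i < l ] g (f i) ≤ ∑[ j < m ] g j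
  ∑-injection zero    m f f-inj g = z≤n
  ∑-injection (suc l) m f f-inj g = begin
    g (f zero) + ∑[ i < l ] g (f (suc i))              ≡⟨ cong (g (f zero) +_) (sum-cong-≗ rest) ⟨
    g (f zero) + ∑[ i < l ] without (f zero) g (f (suc i))
      ≤⟨ ℕP.+-monoʳ-≤ (g (f zero)) (∑-injection l m (f ∘ suc) (λ i j → FinP.suc-injective ∘ f-inj (suc i) (suc j)) _) ⟩
    g (f zero) + ∑[ j < m ] without (f zero) g j       ≡⟨ ∑-split m (f zero) g ⟨
    ∑[ j < m ] g j                                     ∎
    where
    open ℕP.≤-Reasoning
    rest : ∀ i → without (f zero) g (f (suc i)) ≡ g (f (suc i))
    rest i = without-≢ (f zero) (f (suc i)) g (λ e → 0≢1+n (f-inj zero (suc i) (sym e)))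
      where
      0≢1+n : zero ≢ suc i
      0≢1+n ()

  ∑χ≤1 : ∀ m (b : Fin m → Bool) → (∀ i j → T (b i) → T (b j) → i ≡ j) → ∑[ i < m ] χ (b i) ≤ 1
  ∑χ≤1 m b unique with FinP.any? (λ i → T? (b i))
  ... | yes (y , by) = subst (_≤ 1) (sym (∑-single m y (χ ∘ b) (λ i i≢y → χ-false (λ bi → i≢y (unique i y bi by)))))
                             (χ≤1 (b y))
  ... | no  none     = subst (_≤ 1) (sym (∑-zero m (λ i → χ-false (λ bi → none (i , bi))))) z≤n

  ==⇒≡ : ∀ {m} {a b : Fin m} → T (a == b) → a ≡ b
  ==⇒≡ {a = a} {b} t with a FinP.≟ b
  ... | yes a≡b = a≡b

  ≡⇒== : ∀ {m} {a b : Fin m} → a ≡ b → T (a == b)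
  ≡⇒== {a = a} {b} a≡b with a FinP.≟ b
  ... | yes _   = _
  ... | no  a≢b = a≢b a≡b

  ∑-δ : ∀ {m} (u : Fin m) → ∑[ w < m ] χ (u == w) ≡ 1
  ∑-δ {m} u = trans (∑-single m u _ (λ w w≢u → χ-false (w≢u ∘ sym ∘ ==⇒≡))) (χ-true (≡⇒== {a = u} refl))

module Orbits where

  open import Defs using (iter; any; all; orbit)
  open import Data.Bool using (Bool; T; _∨_)
  open import Data.Nat using (ℕ; zero; suc; _+_; _∸_; _≤_; _<_; z≤n; s≤s)
  import Data.Nat.Properties as ℕP
  open import Data.Fin using (Fin; toℕ; fromℕ<; inject)
  import Data.Fin.Properties as FinP
  open import Data.List using ([]; _∷_)
  open import Data.List.Relation.Unary.Any using (Any; here; there)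
  open import Data.List.Relation.Unary.All using (All; []; _∷_)
  import Data.List.Relation.Unary.Any.Properties as AnyP
  import Data.List.Relation.Unary.All.Properties as AllP
  open import Data.Product using (∃; _×_; _,_; proj₁; proj₂)
  open import Data.Sum using (inj₁; inj₂)
  open import Data.Empty using (⊥-elim)
  open import Relation.Binary using (tri<; tri≈; tri>)
  open import Function using (_∘_; Equivalence)
  open import Data.Bool.Properties using (T-∨; T-∧)
  open import Relation.Nullary using (¬_; ¬?)
  open import Relation.Nullary.Decidable using (decidable-stable)
  open import Relation.Binary.PropositionalEquality

  T-any⁻ : ∀ {A : Set} (p : A → Bool) xs → T (any p xs) → Any (T ∘ p) xs
  T-any⁻ p (x ∷ xs) t with Equivalence.to T-∨ t
  ... | inj₁ px   = here px
  ... | inj₂ pxs = there (T-any⁻ p xs pxs)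

  T-any⁺ : ∀ {A : Set} (p : A → Bool) {xs} → Any (T ∘ p) xs → T (any p xs)
  T-any⁺ p (here px)   = Equivalence.from T-∨ (inj₁ px)
  T-any⁺ p (there pxs) = Equivalence.from T-∨ (inj₂ (T-any⁺ p pxs))

  T-all⁻ : ∀ {A : Set} (p : A → Bool) xs → T (all p xs) → All (T ∘ p) xs
  T-all⁻ p []       t = []
  T-all⁻ p (x ∷ xs) t = let px , pxs = Equivalence.to T-∧ t in px ∷ T-all⁻ p xs pxs

  module Orbit {D : ℕ} (φ : Fin D → Fin D) (φ-inj : ∀ x y → φ x ≡ φ y → x ≡ y) where

    iter-+ : ∀ a b x → iter φ (a + b) x ≡ iter φ a (iter φ b x)
    iter-+ zero    b x = refl
    iter-+ (suc a) b x = cong φ (iter-+ a b x)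

    iter-comm : ∀ k x → iter φ k (φ x) ≡ φ (iter φ k x)
    iter-comm k x = trans (sym (iter-+ k 1 x)) (cong (λ m → iter φ m x) (ℕP.+-comm k 1))

    iter-inj : ∀ k x y → iter φ k x ≡ iter φ k y → x ≡ y
    iter-inj zero    x y e = e
    iter-inj (suc k) x y e = iter-inj k x y (φ-inj _ _ e)

    return-gap : ∀ x {i j} → i < j → iter φ i x ≡ iter φ j x →
      ∃ λ δ → i + suc δ ≡ j × iter φ (suc δ) x ≡ x
    return-gap x {i} {j} i<j e with ℕP.m≤n⇒∃[o]m+o≡n i<j
    ... | δ , 1+i+δ≡j = δ , i+1+δ≡j , iter-inj i _ _ (begin
        iter φ i (iter φ (suc δ) x) ≡⟨ iter-+ i (suc δ) x ⟨
        iter φ (i + suc δ) x        ≡⟨ cong (λ m → iter φ m x) i+1+δ≡j ⟩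
        iter φ j x                  ≡⟨ e ⟨
        iter φ i x                  ∎)
      where
      open ≡-Reasoning
      i+1+δ≡j : i + suc δ ≡ j
      i+1+δ≡j = trans (ℕP.+-suc i δ) 1+i+δ≡j

    -- Pigeonhole on x, φ x, …, φᴰ x: every point returns within D steps.
    returns : ∀ x → ∃ λ (p : Fin D) → iter φ (suc (toℕ p)) x ≡ x
    returns x with FinP.pigeonhole (ℕP.n<1+n D) (λ (i : Fin (suc D)) → iter φ (toℕ i) x)
    ... | i , j , i<j , e with return-gap x i<j e
    ...   | δ , i+1+δ≡j , back = fromℕ< δ<D , subst (λ m → iter φ (suc m) x ≡ x) (sym (FinP.toℕ-fromℕ< δ<D)) back
      where
      δ<D : δ < D
      δ<D = ℕP.<-≤-trans (subst (δ <_) i+1+δ≡j (ℕP.m≤n+m (suc δ) (toℕ i))) (ℕP.≤-pred (FinP.toℕ<n j))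

    -- The period ℓ x: the least p ≥ 1 with φᵖ x = x, found as the least
    -- index of Fin D at which x has returned.  It is kept abstract: only the
    -- properties below are used, and unfolding the search is expensive.
    private
      Away : Fin D → Fin D → Set
      Away x p = iter φ (suc (toℕ p)) x ≢ x

    abstract
      private
        firstReturn : ∀ x → ∃ λ (p : Fin D) → ¬ Away x p × (∀ (q : Fin (toℕ p)) → Away x (inject q))
        firstReturn x = FinP.¬∀⟶∃¬-smallest D (Away x) (λ p → ¬? (iter φ (suc (toℕ p)) x FinP.≟ x))
          (λ allAway → allAway (proj₁ (returns x)) (proj₂ (returns x)))

      ℓ : Fin D → ℕ
      ℓ x = suc (toℕ (proj₁ (firstReturn x)))

      ℓ≥1 : ∀ x → 1 ≤ ℓ x
      ℓ≥1 x = s≤s z≤n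

      ℓ≤D : ∀ x → ℓ x ≤ D
      ℓ≤D x = FinP.toℕ<n (proj₁ (firstReturn x))

      ℓ-fix : ∀ x → iter φ (ℓ x) x ≡ x
      ℓ-fix x = decidable-stable (iter φ (ℓ x) x FinP.≟ x) (proj₁ (proj₂ (firstReturn x)))

      ℓ-min : ∀ x j → suc j < ℓ x → iter φ (suc j) x ≢ x
      ℓ-min x j 1+j<ℓ = subst (λ m → iter φ (suc m) x ≢ x) (trans (FinP.toℕ-inject q) (FinP.toℕ-fromℕ< j<p))
          (proj₂ (proj₂ (firstReturn x)) q)
        where
        j<p : j < toℕ (proj₁ (firstReturn x))
        j<p = ℕP.≤-pred 1+j<ℓ
        q : Fin (toℕ (proj₁ (firstReturn x)))
        q = fromℕ< j<p

    ℓ-least : ∀ x p → 1 ≤ p → iter φ p x ≡ x → ℓ x ≤ p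
    ℓ-least x (suc j) _ back = ℕP.≮⇒≥ (λ 1+j<ℓ → ℓ-min x j 1+j<ℓ back)

    iter-injective : ∀ x {i j} → i < ℓ x → j < ℓ x → iter φ i x ≡ iter φ j x → i ≡ j
    iter-injective x {i} {j} i<ℓ j<ℓ e with ℕP.<-cmp i j
    ... | tri≈ _ i≡j _ = i≡j
    ... | tri< i<j _ _ = let δ , i+1+δ≡j , back = return-gap x i<j e in
        ⊥-elim (ℓ-min x δ (ℕP.≤-<-trans (subst (suc δ ≤_) i+1+δ≡j (ℕP.m≤n+m (suc δ) i)) j<ℓ) back)
    ... | tri> _ _ j<i = let δ , j+1+δ≡i , back = return-gap x j<i (sym e) in
        ⊥-elim (ℓ-min x δ (ℕP.≤-<-trans (subst (suc δ ≤_) j+1+δ≡i (ℕP.m≤n+m (suc δ) j)) i<ℓ) back)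

    reduce : ∀ N x → ∃ λ j → j < ℓ x × iter φ N x ≡ iter φ j x
    reduce zero    x = 0 , ℓ≥1 x , refl
    reduce (suc N) x with reduce N x
    ... | j , j<ℓ , e with ℕP.m≤n⇒m<n∨m≡n j<ℓ
    ...   | inj₁ 1+j<ℓ = suc j , 1+j<ℓ , cong φ e
    ...   | inj₂ 1+j≡ℓ = 0 , ℓ≥1 x , trans (cong φ e) (trans (cong (λ m → iter φ m x) 1+j≡ℓ) (ℓ-fix x))

    back : ∀ a x → ∃ λ c → iter φ c (iter φ a x) ≡ x
    back a x with reduce a x
    ... | j , j<ℓ , e = ℓ x ∸ j , (begin
        iter φ (ℓ x ∸ j) (iter φ a x) ≡⟨ cong (iter φ (ℓ x ∸ j)) e ⟩
        iter φ (ℓ x ∸ j) (iter φ j x) ≡⟨ iter-+ (ℓ x ∸ j) j x ⟨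
        iter φ (ℓ x ∸ j + j) x        ≡⟨ cong (λ m → iter φ m x) (ℕP.m∸n+n≡m (ℕP.<⇒≤ j<ℓ)) ⟩
        iter φ (ℓ x) x                ≡⟨ ℓ-fix x ⟩
        x                             ∎)
      where open ≡-Reasoning

    ℓ-φ : ∀ x → ℓ (φ x) ≡ ℓ x
    ℓ-φ x = ℕP.≤-antisym
      (ℓ-least (φ x) (ℓ x) (ℓ≥1 x) (trans (iter-comm (ℓ x) x) (cong φ (ℓ-fix x))))
      (ℓ-least x (ℓ (φ x)) (ℓ≥1 (φ x)) (φ-inj _ _ (trans (sym (iter-comm (ℓ (φ x)) x)) (ℓ-fix (φ x)))))

    ℓ-iter : ∀ k x → ℓ (iter φ k x) ≡ ℓ x
    ℓ-iter zero    x = refl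
    ℓ-iter (suc k) x = trans (ℓ-φ (iter φ k x)) (ℓ-iter k x)

    any-orbit⁻ : ∀ (p : Fin D → Bool) x → T (any p (orbit φ x)) → ∃ λ k → k < D × T (p (iter φ k x))
    any-orbit⁻ p x t = AnyP.applyUpTo⁻ (λ k → k) (AnyP.map⁻ (T-any⁻ p (orbit φ x) t))

    any-orbit⁺ : ∀ (p : Fin D → Bool) x k → k < D → T (p (iter φ k x)) → T (any p (orbit φ x))
    any-orbit⁺ p x k k<D pk = T-any⁺ p (AnyP.map⁺ (AnyP.applyUpTo⁺ (λ k → k) pk k<D))

    all-orbit⁻ : ∀ (p : Fin D → Bool) x → T (all p (orbit φ x)) → ∀ k → k < D → T (p (iter φ k x))
    all-orbit⁻ p x t k k<D = AllP.applyUpTo⁻ (λ k → k) D (AllP.map⁻ (T-all⁻ p (orbit φ x) t)) k<D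

module Discharging where

  open import Data.Nat using (ℕ; suc; _+_; _*_; _∸_; _⊓_; _≤_; s≤s)
  import Data.Nat.Properties as ℕP
  open import Data.Nat.Solver using (module +-*-Solver)
  open +-*-Solver using (solve; _:+_; _:*_; _:=_; con)
  open import Data.Product using (_,_)
  open import Data.Sum using (inj₁; inj₂)
  open import Data.Empty using (⊥)
  open import Relation.Binary.PropositionalEquality

  vertexShare : ℕ → ℕ → ℕ
  vertexShare S l = l ⊓ S ∸ 3

  faceShare : ℕ → ℕ → ℕ
  faceShare S l = S ∸ vertexShare S l

  shares-sum : ∀ S l → vertexShare S l + faceShare S l ≡ S
  shares-sum S l = ℕP.m+[n∸m]≡n (ℕP.≤-trans (ℕP.m∸n≤m (l ⊓ S) 3) (ℕP.m⊓n≤n l S))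

  vertexShare-long : ∀ S l → S ≤ l → vertexShare S l ≡ S ∸ 3
  vertexShare-long S l S≤l = cong (_∸ 3) (ℕP.m≥n⇒m⊓n≡n S≤l)

  -- On a face of length 3 ≤ l ≤ S, 1 + vertexShare is l - 2: the number of
  -- positions of a boundary walk other than its first and last dart.
  vertexShare-short : ∀ S l → 3 ≤ l → l ≤ S → 1 + vertexShare S l ≡ l ∸ 2
  vertexShare-short S (suc (suc (suc l))) (s≤s (s≤s (s≤s _))) l≤S
    rewrite ℕP.m≤n⇒m⊓n≡m l≤S = refl

  faceShare-total : ∀ S l → 3 ≤ S → 3 ≤ l → 3 * S ≤ l * faceShare S l
  faceShare-total S l 3≤S 3≤l with ℕP.≤-total l S
  ... | inj₂ S≤l rewrite vertexShare-long S l S≤l | ℕP.m∸[m∸n]≡n 3≤S =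
    subst (_≤ l * 3) (ℕP.*-comm S 3) (ℕP.*-monoˡ-≤ 3 S≤l)
  ... | inj₁ l≤S with ℕP.m≤n⇒∃[o]m+o≡n 3≤l
  ...   | a , refl with ℕP.m≤n⇒∃[o]m+o≡n l≤S
  ...     | t , refl rewrite ℕP.m≤n⇒m⊓n≡m (ℕP.m≤m+n a t) = begin
    3 * (3 + a + t)                    ≤⟨ ℕP.m≤m+n _ (a * t) ⟩
    3 * (3 + a + t) + a * t            ≡⟨ solve 2 (λ a t → con 3 :* (con 3 :+ a :+ t) :+ a :* t
                                                      := (con 3 :+ a) :* (con 3 :+ t)) refl a t ⟩
    (3 + a) * (3 + t)                  ≡⟨ cong ((3 + a) *_) (ℕP.m+n∸m≡n a (3 + t)) ⟨
    (3 + a) * (a + (3 + t) ∸ a)        ≡⟨ cong (λ s → (3 + a) * (s ∸ a)) (solve 2 (λ a t → a :+ (con 3 :+ t)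
                                                      := con 3 :+ a :+ t) refl a t) ⟩
    (3 + a) * (3 + a + t ∸ a)          ∎
    where open ℕP.≤-Reasoning

  euler-bound : ∀ k n F E → n * (k + 2) + 3 * (k + 2) * F ≤ 2 * E + 2 * E * (k + 2) →
    n + F ≡ E + 2 → k * E + 6 * (k + 2) ≤ 2 * (k + 2) * n
  euler-bound k n F E counts euler = ℕP.+-cancelˡ-≤ C _ _ (subst₂ _≤_ lhs rhs added)
    where
    S C : ℕ
    S = k + 2
    C = n * S + 3 * S * F + 2 * E + 2 * E * S
    -- Add 3S(E + 2) = 3S(n + F) to both sides and cancel the common part C.
    added : n * S + 3 * S * F + 3 * S * (E + 2) ≤ 2 * E + 2 * E * S + 3 * S * (n + F)
    added = ℕP.+-mono-≤ counts (ℕP.≤-reflexive (cong (3 * S *_) (sym euler)))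
    lhs : n * S + 3 * S * F + 3 * S * (E + 2) ≡ C + (k * E + 6 * S)
    lhs = solve 4 (λ k n F E → n :* (k :+ con 2) :+ con 3 :* (k :+ con 2) :* F :+ con 3 :* (k :+ con 2) :* (E :+ con 2)
            := n :* (k :+ con 2) :+ con 3 :* (k :+ con 2) :* F :+ con 2 :* E :+ con 2 :* E :* (k :+ con 2)
               :+ (k :* E :+ con 6 :* (k :+ con 2))) refl k n F E
    rhs : 2 * E + 2 * E * S + 3 * S * (n + F) ≡ C + 2 * S * n
    rhs = solve 4 (λ k n F E → con 2 :* E :+ con 2 :* E :* (k :+ con 2) :+ con 3 :* (k :+ con 2) :* (n :+ F)
            := n :* (k :+ con 2) :+ con 3 :* (k :+ con 2) :* F :+ con 2 :* E :+ con 2 :* E :* (k :+ con 2)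
               :+ con 2 :* (k :+ con 2) :* n) refl k n F E

  sparse-dense-contradiction : ∀ k n E → k * E + 6 * (k + 2) ≤ 2 * (k + 2) * n →
    4 * k * n + 8 * n ≤ 2 * k * E → ⊥
  sparse-dense-contradiction k n E sparse dense = 12S≰0 (ℕP.+-cancelˡ-≤ (2 * k * E) _ _ chain)
    where
    12S≰0 : 12 * (k + 2) ≤ 0 → ⊥
    12S≰0 le with ℕP.≤-trans (ℕP.m≤n+m 2 k) (ℕP.≤-trans (ℕP.m≤m+n (k + 2) (11 * (k + 2))) le)
    ... | ()
    chain : 2 * k * E + 12 * (k + 2) ≤ 2 * k * E + 0
    chain = begin
      2 * k * E + 12 * (k + 2) ≡⟨ solve 2 (λ k E → con 2 :* k :* E :+ con 12 :* (k :+ con 2)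
                                         := con 2 :* (k :* E :+ con 6 :* (k :+ con 2))) refl k E ⟩
      2 * (k * E + 6 * (k + 2)) ≤⟨ ℕP.*-monoʳ-≤ 2 sparse ⟩
      2 * (2 * (k + 2) * n)     ≡⟨ solve 2 (λ k n → con 2 :* (con 2 :* (k :+ con 2) :* n)
                                         := con 4 :* k :* n :+ con 8 :* n) refl k n ⟩
      4 * k * n + 8 * n         ≤⟨ dense ⟩
      2 * k * E                 ≡⟨ ℕP.+-identityʳ _ ⟨
      2 * k * E + 0             ∎
      where open ℕP.≤-Reasoning

module RationalDensity where

  open import Defs using (fromℕ; eightOver)
  open import Data.Nat as ℕ using (ℕ; zero; suc)
  import Data.Nat.Properties as ℕP
  open import Data.Nat.Coprimality using (Coprime)
  open import Data.Nat.Solver using (module +-*-Solver)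
  open +-*-Solver using (solve; _:+_; _:*_; _:=_; con)
  open import Data.Integer as ℤ using (ℤ; +_; -[1+_]; +[1+_])
  import Data.Integer.Properties as ℤP
  import Data.Integer.DivMod as ℤD
  open import Data.Rational as ℚ using (ℚ; mkℚ; 0ℚ; _+_; _*_; ceiling; floor; ↥_; ↧_; -_; 1/_)
  open import Data.Rational.Base using (*<*)
  import Data.Rational.Properties as ℚP
  import Data.Rational.Unnormalised as ℚᵘ
  import Data.Rational.Unnormalised.Properties as ℚᵘP
  open import Data.Product using (∃; _×_; _,_)
  open import Relation.Binary.PropositionalEquality

  -- ⌊q⌋ ↧q ≤ ↥q, from division with remainder.
  floor-bound : ∀ p → floor p ℤ.* ↧ p ℤ.≤ ↥ p
  floor-bound (mkℚ n d _) =
    subst ((n ℤ./ + suc d) ℤ.* + suc d ℤ.≤_) (sym (ℤD.a≡a%n+[a/n]*n n (+ suc d)))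
      (ℤP.i≤j⇒i≤k+j (+ (n ℤ.% + suc d)) ℤP.≤-refl)

  -- ↥q ≤ ⌈q⌉ ↧q, since ⌈q⌉ = -⌊-q⌋.
  ceiling-bound : ∀ q → ↥ q ℤ.≤ ceiling q ℤ.* ↧ q
  ceiling-bound q@(mkℚ _ _ _) = begin
    ↥ q                            ≡⟨ ℤP.neg-involutive (↥ q) ⟨
    ℤ.- (ℤ.- ↥ q)                  ≡⟨ cong ℤ.-_ (ℚP.↥-neg q) ⟨
    ℤ.- ↥ (- q)                    ≤⟨ ℤP.neg-mono-≤ (floor-bound (- q)) ⟩
    ℤ.- (floor (- q) ℤ.* ↧ (- q))  ≡⟨ ℤP.neg-distribˡ-* (floor (- q)) (↧ (- q)) ⟩
    ceiling q ℤ.* ↧ (- q)          ≡⟨ cong (ceiling q ℤ.*_) (ℚP.↧-neg q) ⟩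
    ceiling q ℤ.* ↧ q              ∎
    where open ℤP.≤-Reasoning

  -- For ε = A/B in lowest terms (A, B > 0): 8/ε = 8B/A, cross-multiplied.
  eightOver-cross : ∀ a b .(c : Coprime (suc a) (suc b)) (ε>0 : 0ℚ ℚ.< mkℚ +[1+ a ] b c) →
    ↥ (eightOver (mkℚ +[1+ a ] b c) ε>0) ℤ.* + suc a ≡ + (8 ℕ.* suc b) ℤ.* ↧ (eightOver (mkℚ +[1+ a ] b c) ε>0)
  eightOver-cross a b c ε>0 = cross (ℚᵘP.≃-trans (ℚP.toℚᵘ-homo-* (fromℕ 8) (1/ mkℚ +[1+ a ] b c))
      (ℚᵘ.*≡* (cong (λ x → + (8 ℕ.* suc b) ℤ.* + suc x) (sym (ℕP.+-identityʳ a)))))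
    where
    cross : ∀ {x} → ℚ.toℚᵘ x ℚᵘ.≃ ℚᵘ.mkℚᵘ (+ (8 ℕ.* suc b)) a → ↥ x ℤ.* + suc a ≡ + (8 ℕ.* suc b) ℤ.* ↧ x
    cross {mkℚ _ _ _} (ℚᵘ.*≡* e) = e

  ceiling-natural : ∀ q (N a : ℕ) → ↥ q ℤ.* + suc a ≡ + N ℤ.* ↧ q →
    ∃ λ k → ceiling q ≡ + k × N ℕ.≤ k ℕ.* suc a
  ceiling-natural q N a cross = natural (ceiling q) refl
    where
    A : ℕ
    A = suc a
    N≤⌈q⌉A : + N ℤ.≤ ceiling q ℤ.* + A
    N≤⌈q⌉A = ℤP.*-cancelʳ-≤-pos _ _ (↧ q) (begin
      + N ℤ.* ↧ q                  ≡⟨ cross ⟨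
      ↥ q ℤ.* + A                  ≤⟨ ℤP.*-monoʳ-≤-nonNeg (+ A) (ceiling-bound q) ⟩
      ceiling q ℤ.* ↧ q ℤ.* + A    ≡⟨ ℤP.*-assoc (ceiling q) (↧ q) (+ A) ⟩
      ceiling q ℤ.* (↧ q ℤ.* + A)  ≡⟨ cong (ceiling q ℤ.*_) (ℤP.*-comm (↧ q) (+ A)) ⟩
      ceiling q ℤ.* (+ A ℤ.* ↧ q)  ≡⟨ ℤP.*-assoc (ceiling q) (+ A) (↧ q) ⟨
      ceiling q ℤ.* + A ℤ.* ↧ q    ∎)
      where open ℤP.≤-Reasoning
    natural : ∀ K → ceiling q ≡ K → ∃ λ k → ceiling q ≡ + k × N ℕ.≤ k ℕ.* A
    natural (+ k) e = k , e , ℤP.drop‿+≤+ (subst (+ N ℤ.≤_)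
      (trans (cong (ℤ._* + A) e) (sym (ℤP.pos-* k A))) N≤⌈q⌉A)
    natural -[1+ m ] e with subst (λ K → + N ℤ.≤ K ℤ.* + A) e N≤⌈q⌉A
    ... | ()

  density-cross : ∀ a b .(c : Coprime (suc a) (suc b)) n m →
    (fromℕ 4 + mkℚ +[1+ a ] b c) * fromℕ n ℚ.≤ fromℕ m →
    (4 ℕ.* suc b ℕ.+ suc a) ℕ.* n ℕ.≤ m ℕ.* suc b
  density-cross a b c n m H with ℚᵘP.≤-respʳ-≃ (fromℕ-toℚᵘ m) (ℚᵘP.≤-respˡ-≃ lhs (ℚP.toℚᵘ-mono-≤ H))
    where
    fromℕ-toℚᵘ : ∀ m → ℚ.toℚᵘ (fromℕ m) ℚᵘ.≃ ℚᵘ.mkℚᵘ (+ m) 0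
    fromℕ-toℚᵘ m = ℚP.toℚᵘ-fromℚᵘ (ℚᵘ.mkℚᵘ (+ m) 0)
    lhs : ℚ.toℚᵘ ((fromℕ 4 + mkℚ +[1+ a ] b c) * fromℕ n) ℚᵘ.≃ (ℚᵘ.mkℚᵘ (+ 4) 0 ℚᵘ.+ ℚᵘ.mkℚᵘ +[1+ a ] b) ℚᵘ.* ℚᵘ.mkℚᵘ (+ n) 0
    lhs = ℚᵘP.≃-trans (ℚP.toℚᵘ-homo-* (fromℕ 4 + mkℚ +[1+ a ] b c) (fromℕ n))
            (ℚᵘP.*-cong (ℚP.toℚᵘ-homo-+ (fromℕ 4) (mkℚ +[1+ a ] b c)) (fromℕ-toℚᵘ n))
  ... | ℚᵘ.*≤* cross = ℤP.drop‿+≤+ (subst₂ ℤ._≤_ lhs-ℕ rhs-ℕ cross)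
    where
    A B : ℕ
    A = suc a
    B = suc b
    lhs-ℕ : ((+ 4 ℤ.* + B ℤ.+ + A ℤ.* + 1) ℤ.* + n) ℤ.* + 1 ≡ + ((4 ℕ.* B ℕ.+ A) ℕ.* n)
    lhs-ℕ = begin
      ((+ 4 ℤ.* + B ℤ.+ + A ℤ.* + 1) ℤ.* + n) ℤ.* + 1 ≡⟨ ℤP.*-identityʳ _ ⟩
      (+ 4 ℤ.* + B ℤ.+ + A ℤ.* + 1) ℤ.* + n         ≡⟨ cong (λ x → (+ 4 ℤ.* + B ℤ.+ x) ℤ.* + n) (ℤP.*-identityʳ (+ A)) ⟩
      (+ 4 ℤ.* + B ℤ.+ + A) ℤ.* + n                 ≡⟨ cong (λ x → (x ℤ.+ + A) ℤ.* + n) (ℤP.pos-* 4 B) ⟨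
      (+ (4 ℕ.* B) ℤ.+ + A) ℤ.* + n                 ≡⟨ cong (ℤ._* + n) (ℤP.pos-+ (4 ℕ.* B) A) ⟨
      + (4 ℕ.* B ℕ.+ A) ℤ.* + n                     ≡⟨ ℤP.pos-* (4 ℕ.* B ℕ.+ A) n ⟨
      + ((4 ℕ.* B ℕ.+ A) ℕ.* n)                     ∎
      where open ≡-Reasoning
    rhs-ℕ : + m ℤ.* + ((1 ℕ.* B) ℕ.* 1) ≡ + (m ℕ.* B)
    rhs-ℕ = trans (sym (ℤP.pos-* m _)) (cong (λ x → + (m ℕ.* x)) (trans (ℕP.*-identityʳ _) (ℕP.*-identityˡ B)))

  density-in-ℕ : (ε : ℚ) (ε>0 : 0ℚ ℚ.< ε) (n E : ℕ) →
    (fromℕ 4 + ε) * fromℕ n ℚ.≤ fromℕ (2 ℕ.* E) →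
    ∃ λ k → ceiling (eightOver ε ε>0) ≡ + k × 4 ℕ.* k ℕ.* n ℕ.+ 8 ℕ.* n ℕ.≤ 2 ℕ.* k ℕ.* E
  density-in-ℕ (mkℚ (+ zero)   _ _) (*<* (ℤ.+<+ ())) n E H
  density-in-ℕ (mkℚ -[1+ _ ]   _ _) (*<* ()) n E H
  density-in-ℕ (mkℚ +[1+ a ] b c) ε>0 n E H
    with ceiling-natural (eightOver (mkℚ +[1+ a ] b c) ε>0) (8 ℕ.* suc b) a (eightOver-cross a b c ε>0)
  ... | k , ⌈8/ε⌉≡k , 8B≤kA = k , ⌈8/ε⌉≡k , ℕP.*-cancelˡ-≤ B (begin
    B ℕ.* (4 ℕ.* k ℕ.* n ℕ.+ 8 ℕ.* n)             ≡⟨ solve 3 (λ B k n → B :* (con 4 :* k :* n :+ con 8 :* n)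
                                                      := con 4 :* B :* k :* n :+ (con 8 :* B) :* n) refl B k n ⟩
    4 ℕ.* B ℕ.* k ℕ.* n ℕ.+ (8 ℕ.* B) ℕ.* n      ≤⟨ ℕP.+-monoʳ-≤ (4 ℕ.* B ℕ.* k ℕ.* n) (ℕP.*-monoˡ-≤ n 8B≤kA) ⟩
    4 ℕ.* B ℕ.* k ℕ.* n ℕ.+ (k ℕ.* A) ℕ.* n      ≡⟨ solve 4 (λ B k n A → con 4 :* B :* k :* n :+ (k :* A) :* n
                                                      := k :* ((con 4 :* B :+ A) :* n)) refl B k n A ⟩
    k ℕ.* ((4 ℕ.* B ℕ.+ A) ℕ.* n)                ≤⟨ ℕP.*-monoʳ-≤ k (density-cross a b c n (2 ℕ.* E) H) ⟩
    k ℕ.* (2 ℕ.* E ℕ.* B)                        ≡⟨ solve 3 (λ k E B → k :* (con 2 :* E :* B)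
                                                      := B :* (con 2 :* k :* E)) refl k E B ⟩
    B ℕ.* (2 ℕ.* k ℕ.* E)                        ∎)
    where
    open ℕP.≤-Reasoning
    A B : ℕ
    A = suc a
    B = suc b

module PlaneMaps where

  open import Defs
  open FiniteSums
  open Orbits
  open Discharging
  open import Data.Bool using (Bool; T; not; _∧_)
  open import Data.Bool.Properties using (T-∧; T-not-≡)
  open import Data.Nat using (ℕ; zero; suc; _+_; _*_; _∸_; _≤_; _<_; z≤n; s≤s; _<ᵇ_)
  import Data.Nat.Properties as ℕP
  open import Data.Fin using (Fin; toℕ; fromℕ<)
  import Data.Fin.Properties as FinP
  open import Data.Fin.Permutation using (Permutation′; permutation)
  open import Data.Product using (∃; _×_; _,_; proj₁; proj₂)
  open import Data.Sum using (inj₁; inj₂)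
  open import Data.List using (allFin)
  import Data.List.Relation.Unary.Any.Properties as AnyP
  open import Data.Empty using (⊥; ⊥-elim)
  open import Function using (_∘_; Equivalence)
  open import Relation.Nullary using (yes; no)
  open import Relation.Nullary.Decidable using (_×-dec_)
  open import Relation.Binary using (tri<; tri≈; tri>)
  open import Relation.Binary.PropositionalEquality
  open import Algebra.Properties.Semiring.Sum ℕP.+-*-semiring
    using (sum; sum-syntax; sum-cong-≗; ∑-distrib-+; ∑-comm; sum-permute; *-distribˡ-sum; *-distribʳ-sum)

  module PlaneFacts {n : ℕ} (G : PlaneGraph n) where
    open PlaneGraph G

    next : Fin D → Fin D
    next = φ α σ

    -- α is an involution and σ has an inverse, so next is injective.
    α-inj : ∀ x y → α x ≡ α y → x ≡ y
    α-inj x y e = trans (sym (α-invol x)) (trans (cong α e) (α-invol y))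

    next-inj : ∀ x y → next x ≡ next y → x ≡ y
    next-inj x y e = α-inj x y (trans (sym (σ-left (α x))) (trans (cong σ⁻ e) (σ-left (α y))))

    open Orbit next next-inj public

    mapDeg : Fin n → ℕ
    mapDeg v = ∑[ d < D ] χ (vert d == v)

    deg≤mapDeg : ∀ v → deg v ≤ mapDeg v
    deg≤mapDeg v = subst (_≤ mapDeg v) (sym (count D _)) (∑-mono D (λ d → χ-∧≤ (vert d == v) _))

    -- In particular a graph with a vertex of degree ≥ 3 has darts.
    deg≤D : ∀ v → deg v ≤ D
    deg≤D v = ℕP.≤-trans (deg≤mapDeg v)
      (subst (mapDeg v ≤_) (trans (∑-const D 1) (ℕP.*-identityʳ D)) (∑-mono D (λ d → χ≤1 (vert d == v))))

    -- Handshake lemma for M: the reversal α pairs up the darts.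
    private
      forward : Fin D → ℕ
      forward d = χ (toℕ d <ᵇ toℕ (α d))

      1≡forward+backward : ∀ d → 1 ≡ forward d + forward (α d)
      1≡forward+backward d rewrite α-invol d with ℕP.<-cmp (toℕ d) (toℕ (α d))
      ... | tri< d<αd _ αd≮d = cong₂ _+_ (sym (χ-true (ℕP.<⇒<ᵇ d<αd))) (sym (χ-false (αd≮d ∘ ℕP.<ᵇ⇒< _ _)))
      ... | tri≈ _ d≡αd _   = ⊥-elim (α-nofix d (sym (FinP.toℕ-injective d≡αd)))
      ... | tri> d≮αd _ αd<d = cong₂ _+_ (sym (χ-false (d≮αd ∘ ℕP.<ᵇ⇒< _ _))) (sym (χ-true (ℕP.<⇒<ᵇ αd<d)))

    -- Counting darts by the forward dart of each edge.
    darts≡2edges : D ≡ 2 * edgeCountM α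
    darts≡2edges = begin
      D                                              ≡⟨ trans (∑-const D 1) (ℕP.*-identityʳ D) ⟨
      ∑[ d < D ] 1                                   ≡⟨ sum-cong-≗ 1≡forward+backward ⟩
      ∑[ d < D ] (forward d + forward (α d))         ≡⟨ ∑-distrib-+ forward (forward ∘ α) ⟩
      ∑[ d < D ] forward d + ∑[ d < D ] forward (α d) ≡⟨ cong (∑[ d < D ] forward d +_) (sum-permute forward α-perm) ⟨
      ∑[ d < D ] forward d + ∑[ d < D ] forward d    ≡⟨ cong (∑[ d < D ] forward d +_) (ℕP.+-identityʳ _) ⟨
      2 * ∑[ d < D ] forward d                       ≡⟨ cong (2 *_) (count D _) ⟨
      2 * edgeCountM α                               ∎
      where
      open ≡-Reasoning
      α-perm : Permutation′ D
      α-perm = permutation α α α-invol α-invol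

    edgeCount≤edgeCountM : edgeCount ≤ edgeCountM α
    edgeCount≤edgeCountM = subst₂ _≤_ (sym (count D _)) (sym (count D _))
      (∑-mono D (λ d → χ-∧≤ (toℕ d <ᵇ toℕ (α d)) _))

    next-vert : ∀ d → vert (next d) ≡ vert (α d)
    next-vert d = σ-vert (α d)

    preceding : ∀ x y → next y ≡ x → y ≡ α (σ⁻ x)
    preceding x y e = trans (sym (α-invol y)) (cong α (trans (sym (σ-left (α y))) (cong σ⁻ e)))

    -- A face of length 1 would be a loop.
    no-monogon : ∀ x → next x ≢ x
    no-monogon x fix = loopless x (trans (sym (next-vert x)) (cong vert fix))

    sees-distinct : ∀ {v w} → T (sees v w) → v ≢ w
    sees-distinct t v≡w = subst T (Equivalence.to T-not-≡ (proj₁ (Equivalence.to T-∧ t))) (≡⇒== v≡w)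

    common-face : ∀ v w → T (sees v w) → ∃ λ x → vert x ≡ v × ∃ λ N → vert (iter next N x) ≡ w
    common-face v w t with AnyP.tabulate⁻ (T-any⁻ _ (allFin D) (proj₂ (Equivalence.to T-∧ t)))
    ... | d₀ , on-face with Equivalence.to T-∧ on-face
    ... | v-on , w-on with any-orbit⁻ (λ e → vert e == v) d₀ v-on | any-orbit⁻ (λ e → vert e == w) d₀ w-on
    ... | a , _ , x-at-v | b , _ , w-at-b with back a d₀
    ... | c , back-to-d₀ = x , ==⇒≡ x-at-v , b + c , (begin
        vert (iter next (b + c) x)          ≡⟨ cong vert (iter-+ b c x) ⟩
        vert (iter next b (iter next c x))  ≡⟨ cong (vert ∘ iter next b) back-to-d₀ ⟩
        vert (iter next b d₀)               ≡⟨ ==⇒≡ w-at-b ⟩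
        w                                   ∎)
      where
      open ≡-Reasoning
      x : Fin D
      x = iter next a d₀

    module MinDegree3 (deg≥3 : ∀ v → 3 ≤ deg v) where

      -- A face of length 2 bounded by x and y = next x would force α x = y,
      -- hence σ x = x: x would be the only dart at its vertex.
      no-digon : ∀ x → next (next x) ≢ x
      no-digon x fix = 3≰1 (ℕP.≤-trans (deg≥3 (vert x)) (subst (_≤ 1) (sym (count D _)) at-most-one))
        where
        3≰1 : 3 ≤ 1 → ⊥
        3≰1 (s≤s ())
        αx≡next-x : α x ≡ next x
        αx≡next-x = noMulti (α x) (next x) (sym (σ-vert (α x)))
          (trans (cong vert (α-invol x)) (trans (cong vert (sym fix)) (next-vert (next x))))
        σx≡x : σ x ≡ x
        σx≡x = trans (cong σ (trans (sym (α-invol x)) (cong α αx≡next-x))) fix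
        only-x : ∀ d → vert d ≡ vert x → d ≡ x
        only-x d same with σ-cyc x d (sym same)
        ... | k , σᵏx≡d = trans (sym σᵏx≡d) (fixed k)
          where
          fixed : ∀ k → iter σ k x ≡ x
          fixed zero    = refl
          fixed (suc k) = trans (cong σ (fixed k)) σx≡x
        at-most-one : ∑[ d < D ] χ ((vert d == vert x) ∧ not (aux d)) ≤ 1
        at-most-one = ∑χ≤1 D _ (λ d e td te →
          trans (only-x d (==⇒≡ (proj₁ (Equivalence.to T-∧ td)))) (sym (only-x e (==⇒≡ (proj₁ (Equivalence.to T-∧ te))))))

      face-length≥3 : ∀ x → 3 ≤ ℓ x
      face-length≥3 x = by-length (ℓ x) (ℓ≥1 x) (ℓ-fix x)
        where
        by-length : ∀ l → 1 ≤ l → iter next l x ≡ x → 3 ≤ l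
        by-length 1 _ fix = ⊥-elim (no-monogon x fix)
        by-length 2 _ fix = ⊥-elim (no-digon x fix)
        by-length (suc (suc (suc _))) _ _ = s≤s (s≤s (s≤s z≤n))

      -- A vertex w seen from v appears at an interior position j + 1
      -- (j < ℓ x - 2) of the boundary walk of a face starting at a dart x at v.
      record Sighting (v w : Fin n) : Set where
        field
          x      : Fin D
          x-at-v : vert x ≡ v
          j      : ℕ
          j<     : j < ℓ x ∸ 2
          hits-w : vert (iter next (suc j) x) ≡ w

      -- If w ≠ v lies at position j < ℓ x of the walk from a dart x at v, it
      -- is sighted from x; if it lies at the last position (just before x),
      -- it is sighted from x' = σ⁻ x at its first interior position.
      sighting-at : ∀ {v w} x → vert x ≡ v → v ≢ w →
        ∀ j → j < ℓ x → vert (iter next j x) ≡ w → Sighting v w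
      sighting-at x x-at-v v≢w zero    _   w-at-0 = ⊥-elim (v≢w (trans (sym x-at-v) w-at-0))
      sighting-at {v} x x-at-v v≢w (suc j) j<ℓ w-at with ℕP.m≤n⇒m<n∨m≡n j<ℓ
      ... | inj₁ 2+j<ℓ = record { x = x ; x-at-v = x-at-v ; j = j ; j< = ℕP.∸-monoˡ-≤ 2 2+j<ℓ ; hits-w = w-at }
      ... | inj₂ 2+j≡ℓ = record
          { x = x' ; x-at-v = x'-at-v ; j = 0 ; j< = ℕP.∸-monoˡ-≤ 2 (face-length≥3 x')
          ; hits-w = trans (next-vert x') (trans (cong vert (sym (preceding x _ closes))) w-at) }
        where
        x' : Fin D
        x' = σ⁻ x
        x'-at-v : vert x' ≡ v
        x'-at-v = trans (sym (σ-vert x')) (trans (cong vert (σ-right x)) x-at-v)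
        closes : next (iter next (suc j) x) ≡ x
        closes = trans (cong (λ m → iter next m x) 2+j≡ℓ) (ℓ-fix x)

      sighting : ∀ v w → T (sees v w) → Sighting v w
      sighting v w t =
        let x , x-at-v , N , w-at-N = common-face v w t
            j , j<ℓ , xᴺ≡xʲ = reduce N x
        in sighting-at x x-at-v (sees-distinct t) j j<ℓ (trans (cong vert (sym xᴺ≡xʲ)) w-at-N)

      interiorHits : Fin D → Fin n → ℕ
      interiorHits d w = ∑[ i < ℓ d ∸ 2 ] χ (vert (iter next (suc (toℕ i)) d) == w)

      interiorHits-total : ∀ d → ∑[ w < n ] interiorHits d w ≡ ℓ d ∸ 2
      interiorHits-total d = begin
        ∑[ w < n ] interiorHits d w                    ≡⟨ ∑-comm (λ (w : Fin n) (i : Fin (ℓ d ∸ 2)) → χ (vert (iter next (suc (toℕ i)) d) == w)) ⟩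
        ∑[ i < ℓ d ∸ 2 ] ∑[ w < n ] χ (vert (iter next (suc (toℕ i)) d) == w)
                                                      ≡⟨ sum-cong-≗ (λ (i : Fin (ℓ d ∸ 2)) → ∑-δ (vert (iter next (suc (toℕ i)) d))) ⟩
        ∑[ i < ℓ d ∸ 2 ] 1                             ≡⟨ ∑-const (ℓ d ∸ 2) 1 ⟩
        (ℓ d ∸ 2) * 1                                  ≡⟨ ℕP.*-identityʳ (ℓ d ∸ 2) ⟩
        ℓ d ∸ 2                                        ∎
        where open ≡-Reasoning

      visible-bound : ∀ v → visibleCount v ≤ ∑[ d < D ] (χ (vert d == v) * (ℓ d ∸ 2))
      visible-bound v = begin
        visibleCount v                                         ≡⟨ count n (sees v) ⟩
        ∑[ w < n ] χ (sees v w)                                ≤⟨ ∑-mono n (λ w → χ≤ (seen-once w)) ⟩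
        ∑[ w < n ] ∑[ d < D ] (χ (vert d == v) * interiorHits d w) ≡⟨ ∑-comm (λ w d → χ (vert d == v) * interiorHits d w) ⟩
        ∑[ d < D ] ∑[ w < n ] (χ (vert d == v) * interiorHits d w) ≡⟨ sum-cong-≗ (λ d → *-distribˡ-sum (χ (vert d == v)) (interiorHits d)) ⟨
        ∑[ d < D ] (χ (vert d == v) * ∑[ w < n ] interiorHits d w) ≡⟨ sum-cong-≗ (λ d → cong (χ (vert d == v) *_) (interiorHits-total d)) ⟩
        ∑[ d < D ] (χ (vert d == v) * (ℓ d ∸ 2))                 ∎
        where
        open ℕP.≤-Reasoning
        seen-once : ∀ w → T (sees v w) → 1 ≤ ∑[ d < D ] (χ (vert d == v) * interiorHits d w)
        seen-once w t = ℕP.≤-trans at-j (term≤∑ D x (λ d → χ (vert d == v) * interiorHits d w))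
          where
          open Sighting (sighting v w t)
          i : Fin (ℓ x ∸ 2)
          i = fromℕ< j<
          at-j : 1 ≤ χ (vert x == v) * interiorHits x w
          at-j = begin
            1                                             ≡⟨ χ-true (≡⇒== hits-w) ⟨
            χ (vert (iter next (suc j) x) == w)           ≡⟨ cong (λ m → χ (vert (iter next (suc m) x) == w)) (FinP.toℕ-fromℕ< j<) ⟨
            χ (vert (iter next (suc (toℕ i)) x) == w)     ≤⟨ term≤∑ (ℓ x ∸ 2) i (λ i → χ (vert (iter next (suc (toℕ i)) x) == w)) ⟩
            interiorHits x w                              ≡⟨ ℕP.*-identityˡ (interiorHits x w) ⟨
            1 * interiorHits x w                          ≡⟨ cong (_* interiorHits x w) (χ-true (≡⇒== x-at-v)) ⟨
            χ (vert x == v) * interiorHits x w            ∎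
            where open ℕP.≤-Reasoning

      module Threshold (S : ℕ) (3≤S : 3 ≤ S) where

        charge-split : ∀ v → ∑[ d < D ] (χ (vert d == v) * (1 + vertexShare S (ℓ d)))
                           ≡ mapDeg v + ∑[ d < D ] (χ (vert d == v) * vertexShare S (ℓ d))
        charge-split v = trans (sum-cong-≗ (λ d → trans (ℕP.*-distribˡ-+ (χ (vert d == v)) 1 _)
                                                    (cong (_+ χ (vert d == v) * vertexShare S (ℓ d)) (ℕP.*-identityʳ (χ (vert d == v))))))
                               (∑-distrib-+ (λ d → χ (vert d == v)) (λ d → χ (vert d == v) * vertexShare S (ℓ d)))

        -- Either one of its faces is longer than S (then its share
        -- S - 3 plus degree ≥ 3 suffice), or all are short and it sees at most
        -- ℓ d - 2 = 1 + vertexShare S (ℓ d) vertices from each corner d.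
        vertex-charge : (∀ v → S ≤ visibleCount v) →
          ∀ v → S ≤ ∑[ d < D ] (χ (vert d == v) * (1 + vertexShare S (ℓ d)))
        vertex-charge sees≥S v with FinP.any? (λ d → (vert d FinP.≟ v) ×-dec (S ℕP.<? ℓ d))
        ... | yes (d₀ , d₀-at-v , S<ℓ) = begin
          S                                    ≡⟨ ℕP.m+[n∸m]≡n 3≤S ⟨
          3 + (S ∸ 3)                          ≤⟨ ℕP.+-mono-≤ (ℕP.≤-trans (deg≥3 v) (deg≤mapDeg v)) (ℕP.≤-reflexive long-share) ⟩
          mapDeg v + χ (vert d₀ == v) * vertexShare S (ℓ d₀)
                                               ≤⟨ ℕP.+-monoʳ-≤ (mapDeg v) (term≤∑ D d₀ (λ d → χ (vert d == v) * vertexShare S (ℓ d))) ⟩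
          mapDeg v + ∑[ d < D ] (χ (vert d == v) * vertexShare S (ℓ d))
                                               ≡⟨ charge-split v ⟨
          ∑[ d < D ] (χ (vert d == v) * (1 + vertexShare S (ℓ d))) ∎
          where
          open ℕP.≤-Reasoning
          long-share : S ∸ 3 ≡ χ (vert d₀ == v) * vertexShare S (ℓ d₀)
          long-share rewrite χ-true (≡⇒== d₀-at-v) | vertexShare-long S (ℓ d₀) (ℕP.<⇒≤ S<ℓ) = sym (ℕP.+-identityʳ _)
        ... | no all-short = begin
          S                                                  ≤⟨ sees≥S v ⟩
          visibleCount v                                     ≤⟨ visible-bound v ⟩
          ∑[ d < D ] (χ (vert d == v) * (ℓ d ∸ 2))             ≡⟨ sum-cong-≗ short ⟩
          ∑[ d < D ] (χ (vert d == v) * (1 + vertexShare S (ℓ d))) ∎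
          where
          open ℕP.≤-Reasoning
          short : ∀ d → χ (vert d == v) * (ℓ d ∸ 2) ≡ χ (vert d == v) * (1 + vertexShare S (ℓ d))
          short d = χ*-cong (vert d == v) (λ at-v → sym (vertexShare-short S (ℓ d) (face-length≥3 d)
                      (ℕP.≮⇒≥ (λ S<ℓ → all-short (d , ==⇒≡ at-v , S<ℓ)))))

        vertex-total : (∀ v → S ≤ visibleCount v) → n * S ≤ D + ∑[ d < D ] vertexShare S (ℓ d)
        vertex-total sees≥S = begin
          n * S                                                  ≡⟨ ∑-const n S ⟨
          ∑[ v < n ] S                                           ≤⟨ ∑-mono n (vertex-charge sees≥S) ⟩
          ∑[ v < n ] ∑[ d < D ] (χ (vert d == v) * charge d)     ≡⟨ ∑-comm (λ v d → χ (vert d == v) * charge d) ⟩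
          ∑[ d < D ] ∑[ v < n ] (χ (vert d == v) * charge d)     ≡⟨ sum-cong-≗ once ⟩
          ∑[ d < D ] (1 + vertexShare S (ℓ d))                   ≡⟨ ∑-distrib-+ (λ _ → 1) (λ d → vertexShare S (ℓ d)) ⟩
          ∑[ d < D ] 1 + ∑[ d < D ] vertexShare S (ℓ d)          ≡⟨ cong (_+ ∑[ d < D ] vertexShare S (ℓ d)) (trans (∑-const D 1) (ℕP.*-identityʳ D)) ⟩
          D + ∑[ d < D ] vertexShare S (ℓ d)                     ∎
          where
          open ℕP.≤-Reasoning
          charge : Fin D → ℕ
          charge d = 1 + vertexShare S (ℓ d)
          once : ∀ d → ∑[ v < n ] (χ (vert d == v) * charge d) ≡ charge d
          once d = trans (sym (*-distribʳ-sum (charge d) (λ v → χ (vert d == v))))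
                         (trans (cong (_* charge d) (∑-δ (vert d))) (ℕP.*-identityˡ (charge d)))

        -- Faces are counted by their least darts; onFace r e says that e lies
        -- on the face of r.
        isRep : Fin D → Bool
        isRep r = all (λ e → not (toℕ e <ᵇ toℕ r)) (orbit next r)

        onFace : Fin D → Fin D → Bool
        onFace r e = any (λ x → x == e) (orbit next r)

        rep-least : ∀ r → T (isRep r) → ∀ k → k < D → toℕ r ≤ toℕ (iter next k r)
        rep-least r rep k k<D = ℕP.≮⇒≥ (λ lt → subst T (Equivalence.to T-not-≡ (all-orbit⁻ _ r rep k k<D)) (ℕP.<⇒<ᵇ lt))

        rep≤rep : ∀ r r' e → T (isRep r) → T (onFace r e) → T (onFace r' e) → toℕ r ≤ toℕ r'
        rep≤rep r r' e rep r∼e r'∼e with any-orbit⁻ _ r r∼e | any-orbit⁻ _ r' r'∼e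
        ... | a , _ , rᵃ≡e | b , _ , r'ᵇ≡e with back b r'
        ... | c , r'ᵇᶜ≡r' with reduce (c + a) r
        ... | j , j<ℓ , rᶜᵃ≡rʲ = subst (λ z → toℕ r ≤ toℕ z) rʲ≡r' (rep-least r rep j (ℕP.<-≤-trans j<ℓ (ℓ≤D r)))
          where
          rʲ≡r' : iter next j r ≡ r'
          rʲ≡r' = begin
            iter next j r                 ≡⟨ rᶜᵃ≡rʲ ⟨
            iter next (c + a) r           ≡⟨ iter-+ c a r ⟩
            iter next c (iter next a r)   ≡⟨ cong (iter next c) (trans (==⇒≡ rᵃ≡e) (sym (==⇒≡ r'ᵇ≡e))) ⟩
            iter next c (iter next b r')  ≡⟨ r'ᵇᶜ≡r' ⟩
            r'                            ∎
            where open ≡-Reasoning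

        unique-rep : ∀ e r r' → T (isRep r ∧ onFace r e) → T (isRep r' ∧ onFace r' e) → r ≡ r'
        unique-rep e r r' t t' =
          let rep  , r∼e  = Equivalence.to T-∧ t
              rep' , r'∼e = Equivalence.to T-∧ t'
          in FinP.toℕ-injective (ℕP.≤-antisym (rep≤rep r r' e rep r∼e r'∼e) (rep≤rep r' r e rep' r'∼e r∼e))

        face-collects : ∀ r → 3 * S ≤ ∑[ e < D ] (χ (onFace r e) * faceShare S (ℓ e))
        face-collects r = begin
          3 * S                                                 ≤⟨ faceShare-total S (ℓ r) 3≤S (face-length≥3 r) ⟩
          ℓ r * faceShare S (ℓ r)                               ≡⟨ ∑-const (ℓ r) _ ⟨
          ∑[ i < ℓ r ] faceShare S (ℓ r)                        ≡⟨ sum-cong-≗ on-walk ⟩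
          ∑[ i < ℓ r ] g (walk i)                               ≤⟨ ∑-injection (ℓ r) D walk walk-inj g ⟩
          ∑[ e < D ] g e                                        ∎
          where
          open ℕP.≤-Reasoning
          g : Fin D → ℕ
          g e = χ (onFace r e) * faceShare S (ℓ e)
          walk : Fin (ℓ r) → Fin D
          walk i = iter next (toℕ i) r
          walk-inj : ∀ i j → walk i ≡ walk j → i ≡ j
          walk-inj i j e = FinP.toℕ-injective (iter-injective r (FinP.toℕ<n i) (FinP.toℕ<n j) e)
          on-walk : ∀ i → faceShare S (ℓ r) ≡ g (walk i)
          on-walk i rewrite χ-true (any-orbit⁺ (_== walk i) r (toℕ i) (ℕP.<-≤-trans (FinP.toℕ<n i) (ℓ≤D r)) (≡⇒== {a = walk i} refl))
                          | ℓ-iter (toℕ i) r = sym (ℕP.+-identityʳ _)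

        -- Summing over faces, each dart being on exactly one face.
        face-total : 3 * S * faceCount α σ ≤ ∑[ e < D ] faceShare S (ℓ e)
        face-total = begin
          3 * S * faceCount α σ                                        ≡⟨ cong (3 * S *_) (count D isRep) ⟩
          3 * S * ∑[ r < D ] χ (isRep r)                               ≡⟨ *-distribˡ-sum (3 * S) (χ ∘ isRep) ⟩
          ∑[ r < D ] (3 * S * χ (isRep r))                             ≤⟨ ∑-mono D (λ r → ℕP.≤-trans (ℕP.≤-reflexive (ℕP.*-comm (3 * S) _)) (ℕP.*-monoʳ-≤ (χ (isRep r)) (face-collects r))) ⟩
          ∑[ r < D ] (χ (isRep r) * ∑[ e < D ] (χ (onFace r e) * c e)) ≡⟨ sum-cong-≗ (λ r → *-distribˡ-sum (χ (isRep r)) (λ e → χ (onFace r e) * c e)) ⟩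
          ∑[ r < D ] ∑[ e < D ] (χ (isRep r) * (χ (onFace r e) * c e)) ≡⟨ ∑-comm (λ r e → χ (isRep r) * (χ (onFace r e) * c e)) ⟩
          ∑[ e < D ] ∑[ r < D ] (χ (isRep r) * (χ (onFace r e) * c e)) ≡⟨ sum-cong-≗ (λ e → trans (sum-cong-≗ (λ r → bracket r e)) (sym (*-distribʳ-sum (c e) (λ r → χ (isRep r ∧ onFace r e))))) ⟩
          ∑[ e < D ] ((∑[ r < D ] χ (isRep r ∧ onFace r e)) * c e)     ≤⟨ ∑-mono D (λ e → ℕP.≤-trans (ℕP.*-monoˡ-≤ (c e) (∑χ≤1 D _ (unique-rep e))) (ℕP.≤-reflexive (ℕP.*-identityˡ (c e)))) ⟩
          ∑[ e < D ] c e                                               ∎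
          where
          open ℕP.≤-Reasoning
          c : Fin D → ℕ
          c e = faceShare S (ℓ e)
          bracket : ∀ r e → χ (isRep r) * (χ (onFace r e) * c e) ≡ χ (isRep r ∧ onFace r e) * c e
          bracket r e = trans (sym (ℕP.*-assoc (χ (isRep r)) _ (c e))) (cong (_* c e) (sym (χ-∧ (isRep r) (onFace r e))))

      sparse : ∀ k → 1 ≤ k → (∀ v → k + 2 ≤ visibleCount v) → Fin n →
        k * edgeCountM α + 6 * (k + 2) ≤ 2 * (k + 2) * n
      sparse k 1≤k sees≥S v₀ with euler
      ... | inj₁ D≡0 = ⊥-elim (3≰0 (subst (3 ≤_) D≡0 (ℕP.≤-trans (deg≥3 v₀) (deg≤D v₀))))
        where
        3≰0 : 3 ≤ 0 → ⊥
        3≰0 ()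
      ... | inj₂ euler-formula = euler-bound k n (faceCount α σ) (edgeCountM α) counts euler-formula
        where
        S : ℕ
        S = k + 2
        open Threshold S (ℕP.+-monoˡ-≤ 2 1≤k)
        Σv Σf : ℕ
        Σv = ∑[ d < D ] vertexShare S (ℓ d)
        Σf = ∑[ d < D ] faceShare S (ℓ d)
        shares : Σv + Σf ≡ D * S
        shares = begin
          Σv + Σf                                            ≡⟨ ∑-distrib-+ (λ d → vertexShare S (ℓ d)) (λ d → faceShare S (ℓ d)) ⟨
          ∑[ d < D ] (vertexShare S (ℓ d) + faceShare S (ℓ d)) ≡⟨ sum-cong-≗ (λ d → shares-sum S (ℓ d)) ⟩
          ∑[ d < D ] S                                       ≡⟨ ∑-const D S ⟩
          D * S                                              ∎
          where open ≡-Reasoning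
        counts : n * S + 3 * S * faceCount α σ ≤ 2 * edgeCountM α + 2 * edgeCountM α * S
        counts = subst (λ d → n * S + 3 * S * faceCount α σ ≤ d + d * S) darts≡2edges (begin
          n * S + 3 * S * faceCount α σ  ≤⟨ ℕP.+-mono-≤ (vertex-total sees≥S) face-total ⟩
          D + Σv + Σf                    ≡⟨ ℕP.+-assoc D Σv Σf ⟩
          D + (Σv + Σf)                  ≡⟨ cong (D +_) shares ⟩
          D + D * S                      ∎)
          where open ℕP.≤-Reasoning

      -- For k = 0 the hypothesis says 8n ≤ 0; otherwise
      -- vertices all seeing k + 2 would make M too sparse.
      few-visible : 1 ≤ n → ∀ k → 4 * k * n + 8 * n ≤ 2 * k * edgeCount → ∃ λ v → visibleCount v ≤ 1 + k
      few-visible 1≤n zero dense = ⊥-elim (ℕP.n≮0 (ℕP.≤-trans 1≤n (ℕP.≤-trans (ℕP.m≤n*m n 8) dense)))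
      few-visible 1≤n (suc k) dense with FinP.any? (λ v → visibleCount v ℕP.≤? 2 + k)
      ... | yes found = found
      ... | no none = ⊥-elim (sparse-dense-contradiction (suc k) n (edgeCountM α)
            (sparse (suc k) (s≤s z≤n) sees≥k+3 (fromℕ< 1≤n))
            (ℕP.≤-trans dense (ℕP.*-monoʳ-≤ (2 * suc k) edgeCount≤edgeCountM)))
        where
        sees≥k+3 : ∀ v → suc k + 2 ≤ visibleCount v
        sees≥k+3 v = subst (_≤ visibleCount v) (ℕP.+-comm 2 (suc k)) (ℕP.≰⇒> (λ few → none (v , few)))

open import Defs
open import Data.Nat using (ℕ; _≤_)
open import Data.Fin using (Fin)
open import Data.Product using (∃)
open import Data.Rational using (ℚ; 0ℚ; _<_; _+_; _*_; ceiling)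
open import Data.Integer using (+_)
import Data.Nat as ℕ
import Data.Rational as ℚ
import Data.Integer as ℤ
open import Data.Product using (_,_)
open import Relation.Binary.PropositionalEquality using (subst; sym)

open RationalDensity using (density-in-ℕ)
open PlaneMaps using (module PlaneFacts)

lemma5p6 : (ε : ℚ) (ε>0 : 0ℚ < ε) → ε < fromℕ 2 →
    ∀ {n : ℕ} (G : PlaneGraph n) → 1 ≤ n →
    (∀ v → 3 ≤ PlaneGraph.deg G v) →
    (fromℕ 4 + ε) * fromℕ n ℚ.≤ fromℕ (2 ℕ.* PlaneGraph.edgeCount G) →
    ∃ λ (v : Fin n) →
      + PlaneGraph.visibleCount G v ℤ.≤ + 1 ℤ.+ ceiling (eightOver ε ε>0)
lemma5p6 ε ε>0 _ {n} G 1≤n deg≥3 dense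
  with density-in-ℕ ε ε>0 n (PlaneGraph.edgeCount G) dense
... | k , ⌈8/ε⌉≡k , dense-ℕ with PlaneFacts.MinDegree3.few-visible G deg≥3 1≤n k dense-ℕ
...   | v , few = v , subst (λ K → + PlaneGraph.visibleCount G v ℤ.≤ + 1 ℤ.+ K) (sym ⌈8/ε⌉≡k) (ℤ.+≤+ few)
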